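{- If every branch of a set $S$ is finite, then there is $x\in S$ with $x\cap S=\varnothing$. The converse is not true.
   Context: A branch of a set $S$ is a sequence of nodes $\varnothing=\gamma_0\in\gamma_1\in\cdots\in\gamma_\alpha=S$ in the membership tree of $S$ (nodes are the elements of the transitive closure of $S$), from the root $S$ down to the terminal $\varnothing$; it is finite if it has finitely many nodes. Sets with infinite branches, such as a set $S$ satisfying $S=\{\varnothing,S\}$, are allowed (no axiom of regularity is assumed). -}

module Defs where

open import Data.Nat using (ℕ; zero; suc)
open import Data.Product using (Σ; _×_; Σ-syntax)
open import Data.Sum using (_⊎_)
open import Relation.Nullary using (¬_)
open import Relation.Binary.PropositionalEquality using (_≡_)
open import Function.Bundles using (_⇔_)

-- A universe of sets: a carrier of sets with a membership relation.
-- No regularity (foundation) axiom is assumed; equality of sets is _≡_.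
record SetUniverse : Set₁ where
  field
    V   : Set
    _∈_ : V → V → Set

module _ (U : SetUniverse) where
  open SetUniverse U

  IsEmpty : V → Set
  IsEmpty x = ∀ y → ¬ (y ∈ x)

  Nonempty : V → Set
  Nonempty S = Σ[ x ∈ V ] (x ∈ S)

  DisjointFrom : V → V → Set
  DisjointFrom x S = ∀ y → y ∈ x → ¬ (y ∈ S)

  InfiniteBranch : V → Set
  InfiniteBranch S = Σ[ γ ∈ (ℕ → V) ] (γ zero ≡ S × (∀ n → γ (suc n) ∈ γ n))

  AllBranchesFinite : V → Set
  AllBranchesFinite S = ¬ InfiniteBranch S

  IsPairEmptySelf : V → Set
  IsPairEmptySelf S = ∀ y → (y ∈ S) ⇔ (IsEmpty y ⊎ y ≡ S)

{-# OPTIONS --safe #-}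
-- If no element of S were disjoint from S, every element of S would have an
-- element in S, and following such elements from S downwards would give an
-- infinite branch.  The converse fails for S = {∅, S}: its member ∅ is disjoint from S,
-- yet S ∋ S ∋ S ∋ ⋯ is an infinite branch.
module Submission where

open import Defs
open import Data.Product using (Σ; _×_; Σ-syntax; _,_; proj₁; proj₂)
open import Data.Sum using (inj₁; inj₂)
open import Data.Nat using (ℕ; zero; suc)
open import Data.Empty using (⊥-elim)
open import Data.Nat.GeneralisedArithmetic using (iterate)
open import Relation.Nullary using (¬_; yes; no)
open import Relation.Binary.PropositionalEquality using (refl)
open import Function.Bundles using (Equivalence)
open import Axiom.ExcludedMiddle using (ExcludedMiddle)
open import Axiom.DoubleNegationElimination using (em⇒dne)
open import Level using (0ℓ)

module _ (U : SetUniverse) where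
  open SetUniverse U

  MinimalElement : V → Set
  MinimalElement S = Σ[ x ∈ V ] (x ∈ S × DisjointFrom U x S)

  Meets : V → V → Set
  Meets x S = Σ[ y ∈ V ] (y ∈ x × y ∈ S)

  ¬DisjointFrom⇒Meets : ExcludedMiddle 0ℓ → ∀ {x S} →
                        ¬ DisjointFrom U x S → Meets x S
  ¬DisjointFrom⇒Meets em ¬disjoint = em⇒dne em λ ¬meets →
    ¬disjoint λ y y∈x y∈S → ¬meets (y , y∈x , y∈S)

  ∈-InfiniteBranch : ∀ {x S} → x ∈ S → InfiniteBranch U x → InfiniteBranch U S
  ∈-InfiniteBranch {S = S} x∈S (γ , γ₀≡x , γ-step) = δ , refl , δ-step
    where
    δ : ℕ → V
    δ zero    = S
    δ (suc n) = γ n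

    δ-step : ∀ n → δ (suc n) ∈ δ n
    δ-step zero    rewrite γ₀≡x = x∈S
    δ-step (suc n) = γ-step n

  module _ {S : V} (descend : ∀ x → x ∈ S → Meets x S) where

    private
      Element : Set
      Element = Σ[ x ∈ V ] (x ∈ S)

      next : Element → Element
      next (x , x∈S) = let (y , _ , y∈S) = descend x x∈S in y , y∈S

      next-∈ : ∀ p → proj₁ (next p) ∈ proj₁ p
      next-∈ (x , x∈S) = proj₁ (proj₂ (descend x x∈S))

      iterate-∈ : ∀ p n → proj₁ (iterate next (next p) n) ∈ proj₁ (iterate next p n)
      iterate-∈ p zero    = next-∈ p
      iterate-∈ p (suc n) = iterate-∈ (next p) n

    descending⇒InfiniteBranch : ∀ {x} → x ∈ S → InfiniteBranch U x
    descending⇒InfiniteBranch {x} x∈S =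
      (λ n → proj₁ (iterate next (x , x∈S) n)) , refl , iterate-∈ (x , x∈S)

  AllBranchesFinite⇒MinimalElement : ExcludedMiddle 0ℓ → ∀ {S} →
    Nonempty U S → AllBranchesFinite U S → MinimalElement S
  AllBranchesFinite⇒MinimalElement em {S} (x , x∈S) finite with em {MinimalElement S}
  ... | yes minimal = minimal
  ... | no ¬minimal =
    ⊥-elim (finite (∈-InfiniteBranch x∈S (descending⇒InfiniteBranch descend x∈S)))
    where
    descend : ∀ y → y ∈ S → Meets y S
    descend y y∈S = ¬DisjointFrom⇒Meets em λ disjoint → ¬minimal (y , y∈S , disjoint)

  IsEmpty⇒DisjointFrom : ∀ {e} S → IsEmpty U e → DisjointFrom U e S
  IsEmpty⇒DisjointFrom _ empty y y∈e _ = empty y y∈e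

  ∈-self⇒InfiniteBranch : ∀ {S} → S ∈ S → InfiniteBranch U S
  ∈-self⇒InfiniteBranch S∈S = (λ _ → _) , refl , λ _ → S∈S

  module _ {S : V} (pair : IsPairEmptySelf U S) where

    IsPairEmptySelf⇒¬AllBranchesFinite : ¬ AllBranchesFinite U S
    IsPairEmptySelf⇒¬AllBranchesFinite finite =
      finite (∈-self⇒InfiniteBranch (Equivalence.from (pair S) (inj₂ refl)))

    IsPairEmptySelf⇒MinimalElement : Σ[ e ∈ V ] IsEmpty U e → MinimalElement S
    IsPairEmptySelf⇒MinimalElement (e , empty) =
      e , Equivalence.from (pair e) (inj₁ empty) , IsEmpty⇒DisjointFrom S empty

corollary135 :
    ((U : SetUniverse) → ExcludedMiddle 0ℓ → (S : SetUniverse.V U) →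
      Nonempty U S → AllBranchesFinite U S →
      Σ[ x ∈ SetUniverse.V U ] (SetUniverse._∈_ U x S × DisjointFrom U x S))
    ×
    ((U : SetUniverse) → (S : SetUniverse.V U) →
      Σ[ e ∈ SetUniverse.V U ] IsEmpty U e → IsPairEmptySelf U S →
      Σ[ x ∈ SetUniverse.V U ] (SetUniverse._∈_ U x S × DisjointFrom U x S)
        × ¬ AllBranchesFinite U S)
corollary135 =
  (λ U em S → AllBranchesFinite⇒MinimalElement U em) ,
  λ U S empty pair →
    let (e , e∈S , disjoint) = IsPairEmptySelf⇒MinimalElement U pair empty
    in  e , (e∈S , disjoint) , IsPairEmptySelf⇒¬AllBranchesFinite U pair
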